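{- Let $\mathcal{R}$ be the Rado graph with vertex set $V$ and let $\mathcal{H}$ be the hypergraph on $V$ whose edges are the subsets of $V$ inducing a subgraph of $\mathcal{R}$ isomorphic to $\mathcal{R}$. Then: (a) $\mathrm{Aut}(\mathcal{H})$ is a proper subgroup of $\mathrm{FAut}(\mathcal{H})$; (b) $\mathrm{Aut}_2(\mathcal{R}) \leq \mathrm{Aut}(\mathcal{H})$ and $\mathrm{Aut}_3(\mathcal{R}) \leq \mathrm{FAut}(\mathcal{H})$; (c) $\mathrm{FSym}(V) \leq \mathrm{FAut}(\mathcal{H})$, but $\mathrm{FSym}(V) \cap \mathrm{Aut}(\mathcal{H}) = 1$.
   Context: The Rado graph $\mathcal{R}$ is the unique (up to isomorphism) countable graph such that for all finite disjoint sets of vertices $A, B$ there is a vertex adjacent to every vertex of $A$ and to no vertex of $B$. A permutation $g$ of $V$ changes the adjacency of $v,w$ if exactly one of $\{v,w\}$, $\{v^g,w^g\}$ is an edge of $\mathcal{R}$. $\mathrm{Aut}_2(\mathcal{R})$ is the group of permutations of $V$ which change only finitely many adjacencies at each vertex (i.e. for each $v$ there are finitely many $w$ whose adjacency with $v$ is changed). $\mathrm{Aut}_3(\mathcal{R})$ is the group of permutations which change only finitely many adjacencies at all but finitely many vertices. $\mathrm{FSym}(V)$ is the group of finitary permutations of $V$ (moving only finitely many points). $\mathrm{Aut}(\mathcal{H})$ is the group of permutations $g$ of $V$ such that $E$ is an edge iff $Eg$ is an edge. $\mathrm{FAut}(\mathcal{H})$ is the set of permutations $g$ of $V$ for which there is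 a finite $S \subseteq V$ such that for every edge $E$ of $\mathcal{H}$, both $(E\setminus S)g$ and $(E\setminus S)g^{ -1}$ are edges of $\mathcal{H}$ (this is a group). -}

module Defs where

open import Data.Nat using (ℕ)
open import Data.Bool using (Bool; true; false)
open import Data.List using (List)
open import Data.List.Membership.Propositional using (_∈_; _∉_)
open import Data.Product using (Σ; ∃; _×_; _,_)
open import Relation.Nullary using (¬_)
open import Relation.Binary.PropositionalEquality using (_≡_; _≢_)

Adj : Set
Adj = ℕ → ℕ → Bool

Symmetric : Adj → Set
Symmetric adj = ∀ v w → adj v w ≡ adj w v

Irreflexive : Adj → Set
Irreflexive adj = ∀ v → adj v v ≡ false

Disjoint : List ℕ → List ℕ → Set
Disjoint A B = ∀ x → x ∈ A → x ∉ B

Extension : Adj → Set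
Extension adj = ∀ (A B : List ℕ) → Disjoint A B →
  ∃ λ z → (∀ a → a ∈ A → adj z a ≡ true) × (∀ b → b ∈ B → adj z b ≡ false)

-- (V, adj) is the Rado graph (the unique countable graph with the
-- extension property).
IsRado : Adj → Set
IsRado adj = Symmetric adj × Irreflexive adj × Extension adj

Finite : (ℕ → Set) → Set
Finite P = ∃ λ (L : List ℕ) → ∀ x → P x → x ∈ L

record Perm : Set where
  field
    fun : ℕ → ℕ
    inv : ℕ → ℕ
    inv-fun : ∀ x → inv (fun x) ≡ x
    fun-inv : ∀ x → fun (inv x) ≡ x
open Perm public

Subset : Set₁
Subset = ℕ → Set

_·_ : Subset → Perm → Subset
(E · g) x = E (inv g x)

_·⁻¹_ : Subset → Perm → Subset
(E ·⁻¹ g) x = E (fun g x)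

_∖_ : Subset → List ℕ → Subset
(E ∖ S) x = E x × x ∉ S

InducesRado : Adj → Subset → Set
InducesRado adj E =
  Σ (ℕ → ℕ) λ f → Σ (∀ i → E (f i)) λ mem → Σ ((x : ℕ) → E x → ℕ) λ h →
    (∀ x (p : E x) → f (h x p) ≡ x) ×
    (∀ i → h (f i) (mem i) ≡ i) ×
    (∀ i j → adj (f i) (f j) ≡ adj i j)

Edge : Adj → Subset → Set
Edge adj E = InducesRado adj E

Changes : Adj → Perm → ℕ → ℕ → Set
Changes adj g v w = adj v w ≢ adj (fun g v) (fun g w)

InAutH : Adj → Perm → Set₁
InAutH adj g = ∀ (E : Subset) →
  (Edge adj E → Edge adj (E · g)) × (Edge adj (E · g) → Edge adj E)

InFAutH : Adj → Perm → Set₁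
InFAutH adj g = Σ (List ℕ) λ S → ∀ (E : Subset) → Edge adj E →
  Edge adj ((E ∖ S) · g) × Edge adj ((E ∖ S) ·⁻¹ g)

InAut₂ : Adj → Perm → Set
InAut₂ adj g = ∀ v → Finite (Changes adj g v)

InAut₃ : Adj → Perm → Set
InAut₃ adj g = Σ (List ℕ) λ S → ∀ v → v ∉ S → Finite (Changes adj g v)

InFSym : Perm → Set
InFSym g = Σ (List ℕ) λ S → ∀ x → x ∉ S → fun g x ≡ x

IsIdentity : Perm → Set
IsIdentity g = ∀ x → fun g x ≡ x

-- The hyperedges are the sets carrying a copy of R, and by back-and-forth a set is such a copy as
-- soon as it has the extension property. If g changes only finitely many adjacencies at each point of
-- E ∖ S, then (E ∖ S)g has the extension property: a witness for finite A, B can be taken in E,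
-- outside S and outside the finitely many vertices whose adjacency to A ∪ B is changed by g.
-- This gives (b), Aut(H) ≤ FAut(H), and FSym(V) ≤ Aut₃(R) ≤ FAut(H). If a finitary g moves x,
-- then x is adjacent to every other point of C = {x} ∪ (N(x) ∖ S), which no copy of R allows, while
-- Cg is an edge; hence FSym(V) ∩ Aut(H) = 1, and a transposition lies in FAut(H) ∖ Aut(H).

module Submission where

open import Defs
open import Data.Bool using (Bool; true; false)
open import Data.Bool.Properties using () renaming (_≟_ to _≟ᵇ_)
open import Data.Empty using (⊥-elim)
open import Data.List using (List; []; _∷_; _++_; map; filter)
open import Data.List.Membership.Propositional using (_∈_; _∉_)
open import Data.List.Membership.Propositional.Properties
  using (∈-++⁺ˡ; ∈-++⁺ʳ; ∈-++⁻; ∈-map⁺; ∈-map⁻; ∈-filter⁺; ∈-map∘filter⁺; ∈-map∘filter⁻)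
open import Data.List.Relation.Binary.Subset.Propositional using (_⊆_)
open import Data.List.Relation.Unary.All as All using (All; []; _∷_)
open import Data.List.Relation.Unary.All.Properties using (all-filter; map⁺) renaming (++⁺ to _++ᴬ_)
open import Data.List.Relation.Unary.Any using (here; there)
open import Data.Nat using (ℕ; zero; suc; _+_; _≟_)
open import Data.Nat.Properties using (+-comm; 1+n≢0)
open import Data.List.Membership.DecPropositional _≟_ using (_∈?_)
open import Data.Product using (Σ; ∃; _×_; _,_; proj₁; proj₂; swap)
open import Data.Sum using (_⊎_; inj₁; inj₂)
open import Data.Unit using (⊤; tt)
open import Function using (_∘_)
open import Function.Definitions using (Injective)
open import Relation.Nullary using (¬_; yes; no)
open import Relation.Nullary.Decidable using (¬?; _⊎-dec_; _×-dec_; decidable-stable)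
open import Relation.Unary using (Decidable)
open import Relation.Binary.PropositionalEquality

HasExtension : (ℕ → Set) → Adj → Set
HasExtension D E = ∀ A B → All D A → All D B → Disjoint A B →
  ∃ λ z → D z × (∀ a → a ∈ A → E z a ≡ true) × (∀ b → b ∈ B → E z b ≡ false)

true≢false : true ≢ false
true≢false ()

record Graph : Set₁ where
  field
    Vertex          : ℕ → Set
    vertex?         : Decidable Vertex
    adjacent        : Adj
    adjacent-sym    : Symmetric adjacent
    adjacent-irrefl : Irreflexive adjacent
    extension       : HasExtension Vertex adjacent

  -- Take w adjacent to A, B and X ∩ Vertex, then z adjacent to A but not to B ∪ {w}:
  -- a vertex z in X would be adjacent to w.
  extension-avoiding : ∀ A B X → All Vertex A → All Vertex B → Disjoint A B →
    ∃ λ z → Vertex z × z ∉ X × (∀ a → a ∈ A → adjacent z a ≡ true) × (∀ b → b ∈ B → adjacent z b ≡ false)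
  extension-avoiding A B X vA vB A#B = z , vz , z∉X , z~A , (λ b b∈B → z≁B∪w b (∈-++⁺ˡ b∈B))
    where
    X′ = filter vertex? X
    w-spec = extension (A ++ B ++ X′) [] (vA ++ᴬ (vB ++ᴬ all-filter vertex? X)) [] (λ _ _ ())
    w = proj₁ w-spec
    vw = proj₁ (proj₂ w-spec)
    w~ = proj₁ (proj₂ (proj₂ w-spec))
    w∉A : w ∉ A
    w∉A w∈A = true≢false (trans (sym (w~ w (∈-++⁺ˡ w∈A))) (adjacent-irrefl w))
    A#B∪w : Disjoint A (B ++ w ∷ [])
    A#B∪w x x∈A x∈B∪w with ∈-++⁻ B x∈B∪w
    ... | inj₁ x∈B = A#B x x∈A x∈B
    ... | inj₂ (here refl) = w∉A x∈A
    z-spec = extension A (B ++ w ∷ []) vA (vB ++ᴬ (vw ∷ [])) A#B∪w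
    z = proj₁ z-spec
    vz = proj₁ (proj₂ z-spec)
    z~A = proj₁ (proj₂ (proj₂ z-spec))
    z≁B∪w = proj₂ (proj₂ (proj₂ z-spec))
    z∉X : z ∉ X
    z∉X z∈X = true≢false (begin
      true          ≡⟨ sym (w~ z (∈-++⁺ʳ A (∈-++⁺ʳ B (∈-filter⁺ vertex? z∈X vz)))) ⟩
      adjacent w z  ≡⟨ adjacent-sym w z ⟩
      adjacent z w  ≡⟨ z≁B∪w w (∈-++⁺ʳ B (here refl)) ⟩
      false         ∎)
      where open ≡-Reasoning

  neighbourhood-injective : ∀ {i j} → Vertex i → Vertex j →
    (∀ z → Vertex z → adjacent z i ≡ adjacent z j) → i ≡ j
  neighbourhood-injective {i} {j} vi vj same with i ≟ j
  ... | yes i≡j = i≡j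
  ... | no i≢j with extension (i ∷ []) (j ∷ []) (vi ∷ []) (vj ∷ []) (λ { _ (here refl) (here refl) → i≢j refl })
  ...   | z , vz , z~i , z≁j =
    ⊥-elim (true≢false (trans (sym (z~i i (here refl))) (trans (same z vz) (z≁j j (here refl)))))

Pairs : Set
Pairs = List (ℕ × ℕ)

∈-unswap : ∀ {a b} {P : Pairs} → (b , a) ∈ map swap P → (a , b) ∈ P
∈-unswap b,a∈ with ∈-map⁻ swap b,a∈
... | _ , a,b∈ , refl = a,b∈

module _ (G H : Graph) where
  private
    module G = Graph G
    module H = Graph H

  record IsPartialIso (P : Pairs) : Set where
    field
      dom        : ∀ {a b} → (a , b) ∈ P → G.Vertex a
      cod        : ∀ {a b} → (a , b) ∈ P → H.Vertex b
      functional : ∀ {a b c d} → (a , b) ∈ P → (c , d) ∈ P → a ≡ c → b ≡ d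
      injective  : ∀ {a b c d} → (a , b) ∈ P → (c , d) ∈ P → b ≡ d → a ≡ c
      preserves  : ∀ {a b c d} → (a , b) ∈ P → (c , d) ∈ P → G.adjacent a c ≡ H.adjacent b d

  record Enlargement (P : Pairs) (Covers : Pairs → Set) : Set where
    field
      pairs        : Pairs
      isPartialIso : IsPartialIso pairs
      ⊇old         : P ⊆ pairs
      covers       : Covers pairs

  []-isPartialIso : IsPartialIso []
  []-isPartialIso = record
    { dom = λ () ; cod = λ () ; functional = λ () ; injective = λ () ; preserves = λ () }

  ∷-isPartialIso : ∀ {P a b} → IsPartialIso P → G.Vertex a → H.Vertex b →
    (∀ {c d} → (c , d) ∈ P → a ≢ c × b ≢ d × G.adjacent a c ≡ H.adjacent b d) →
    IsPartialIso ((a , b) ∷ P)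
  ∷-isPartialIso {P} {a} {b} iso va vb fresh = record
    { dom = dom′ ; cod = cod′ ; functional = functional′ ; injective = injective′ ; preserves = preserves′ }
    where
    open IsPartialIso iso
    dom′ : ∀ {c d} → (c , d) ∈ (a , b) ∷ P → G.Vertex c
    dom′ (here refl) = va
    dom′ (there m) = dom m
    cod′ : ∀ {c d} → (c , d) ∈ (a , b) ∷ P → H.Vertex d
    cod′ (here refl) = vb
    cod′ (there m) = cod m
    functional′ : ∀ {c d c′ d′} → (c , d) ∈ (a , b) ∷ P → (c′ , d′) ∈ (a , b) ∷ P → c ≡ c′ → d ≡ d′
    functional′ (here refl) (here refl) _ = refl
    functional′ (here refl) (there n) a≡c′ = ⊥-elim (proj₁ (fresh n) a≡c′)
    functional′ (there m) (here refl) c≡a = ⊥-elim (proj₁ (fresh m) (sym c≡a))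
    functional′ (there m) (there n) = functional m n
    injective′ : ∀ {c d c′ d′} → (c , d) ∈ (a , b) ∷ P → (c′ , d′) ∈ (a , b) ∷ P → d ≡ d′ → c ≡ c′
    injective′ (here refl) (here refl) _ = refl
    injective′ (here refl) (there n) b≡d′ = ⊥-elim (proj₁ (proj₂ (fresh n)) b≡d′)
    injective′ (there m) (here refl) d≡b = ⊥-elim (proj₁ (proj₂ (fresh m)) (sym d≡b))
    injective′ (there m) (there n) = injective m n
    preserves′ : ∀ {c d c′ d′} → (c , d) ∈ (a , b) ∷ P → (c′ , d′) ∈ (a , b) ∷ P →
      G.adjacent c c′ ≡ H.adjacent d d′
    preserves′ (here refl) (here refl) = trans (G.adjacent-irrefl a) (sym (H.adjacent-irrefl b))
    preserves′ (here refl) (there n) = proj₂ (proj₂ (fresh n))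
    preserves′ (there m) (here refl) =
      trans (G.adjacent-sym _ a) (trans (proj₂ (proj₂ (fresh m))) (H.adjacent-sym b _))
    preserves′ (there m) (there n) = preserves m n

  unchanged : ∀ {P Covers} → IsPartialIso P → Covers P → Enlargement P Covers
  unchanged {P} iso covered = record { pairs = P ; isPartialIso = iso ; ⊇old = λ m → m ; covers = covered }

  -- The image of a new vertex a is chosen adjacent exactly to the images of the neighbours of a,
  -- and outside the current codomain.
  forth : ∀ {P} → IsPartialIso P → (a : ℕ) → Enlargement P (λ P′ → G.Vertex a → ∃ λ b → (a , b) ∈ P′)
  forth {P} iso a with a ∈? map proj₁ P
  ... | yes a∈dom with ∈-map⁻ proj₁ a∈dom
  ...   | (_ , b) , a,b∈P , refl = unchanged iso (λ _ → b , a,b∈P)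
  forth {P} iso a | no a∉dom with G.vertex? a
  ... | no ¬va = unchanged iso (λ va → ⊥-elim (¬va va))
  ... | yes va = record
    { pairs = (a , b) ∷ P ; isPartialIso = ∷-isPartialIso iso va vb fresh
    ; ⊇old = there ; covers = λ _ → b , here refl }
    where
    open IsPartialIso iso
    images : Bool → List ℕ
    images t = map proj₂ (filter (λ p → G.adjacent a (proj₁ p) ≟ᵇ t) P)
    images⁻ : ∀ {t d} → d ∈ images t → ∃ λ c → (c , d) ∈ P × G.adjacent a c ≡ t
    images⁻ {t} d∈ with ∈-map∘filter⁻ proj₂ (λ p → G.adjacent a (proj₁ p) ≟ᵇ t) d∈
    ... | (c , _) , c,d∈P , refl , a~c = c , c,d∈P , a~c
    images⁺ : ∀ {t c d} → (c , d) ∈ P → G.adjacent a c ≡ t → d ∈ images t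
    images⁺ {t} c,d∈P a~c = ∈-map∘filter⁺ proj₂ (λ p → G.adjacent a (proj₁ p) ≟ᵇ t) (_ , c,d∈P , refl , a~c)
    images-vertices : ∀ t → All H.Vertex (images t)
    images-vertices t = All.tabulate (λ d∈ → cod (proj₁ (proj₂ (images⁻ d∈))))
    images-disjoint : Disjoint (images true) (images false)
    images-disjoint d d∈₁ d∈₂ with images⁻ d∈₁ | images⁻ d∈₂
    ... | c₁ , m₁ , a~c₁ | c₂ , m₂ , a≁c₂ =
      true≢false (trans (sym a~c₁) (trans (cong (G.adjacent a) (injective m₁ m₂ refl)) a≁c₂))
    b-spec = H.extension-avoiding (images true) (images false) (map proj₂ P)
               (images-vertices true) (images-vertices false) images-disjoint
    b = proj₁ b-spec
    vb = proj₁ (proj₂ b-spec)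
    b∉cod = proj₁ (proj₂ (proj₂ b-spec))
    b~ = proj₁ (proj₂ (proj₂ (proj₂ b-spec)))
    b≁ = proj₂ (proj₂ (proj₂ (proj₂ b-spec)))
    same-adjacency : ∀ {c d} → (c , d) ∈ P → ∀ t → G.adjacent a c ≡ t → G.adjacent a c ≡ H.adjacent b d
    same-adjacency {d = d} c,d∈P true a~c = trans a~c (sym (b~ d (images⁺ c,d∈P a~c)))
    same-adjacency {d = d} c,d∈P false a≁c = trans a≁c (sym (b≁ d (images⁺ c,d∈P a≁c)))
    fresh : ∀ {c d} → (c , d) ∈ P → a ≢ c × b ≢ d × G.adjacent a c ≡ H.adjacent b d
    fresh c,d∈P =
      (λ { refl → a∉dom (∈-map⁺ proj₁ c,d∈P) }) , (λ { refl → b∉cod (∈-map⁺ proj₂ c,d∈P) }) ,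
      same-adjacency c,d∈P _ refl

swap-isPartialIso : ∀ {G H P} → IsPartialIso G H P → IsPartialIso H G (map swap P)
swap-isPartialIso iso = record
  { dom = cod ∘ ∈-unswap
  ; cod = dom ∘ ∈-unswap
  ; functional = λ m n → injective (∈-unswap m) (∈-unswap n)
  ; injective = λ m n → functional (∈-unswap m) (∈-unswap n)
  ; preserves = λ m n → sym (preserves (∈-unswap m) (∈-unswap n))
  }
  where open IsPartialIso iso

back : ∀ {G H P} → IsPartialIso G H P → (b : ℕ) →
  Enlargement G H P (λ P′ → Graph.Vertex H b → ∃ λ a → (a , b) ∈ P′)
back {G} {H} iso b = record
  { pairs = map swap pairs
  ; isPartialIso = swap-isPartialIso isPartialIso
  ; ⊇old = ∈-map⁺ swap ∘ ⊇old ∘ ∈-map⁺ swap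
  ; covers = λ vb → let (a , b,a∈) = covers vb in a , ∈-map⁺ swap b,a∈
  }
  where open Enlargement (forth H G (swap-isPartialIso iso) b)

round : ∀ {G H P} → IsPartialIso G H P → (n : ℕ) →
  Enlargement G H P (λ P′ → (Graph.Vertex G n → ∃ λ b → (n , b) ∈ P′) × (Graph.Vertex H n → ∃ λ a → (a , n) ∈ P′))
round {G} {H} iso n = record
  { pairs = Back.pairs
  ; isPartialIso = Back.isPartialIso
  ; ⊇old = Back.⊇old ∘ Forth.⊇old
  ; covers = (λ vn → let (b , n,b∈) = Forth.covers vn in b , Back.⊇old n,b∈) , Back.covers
  }
  where
  module Forth = Enlargement (forth G H iso n)
  module Back = Enlargement (back Forth.isPartialIso n)

record Isomorphism (G H : Graph) : Set where
  field
    to          : ℕ → ℕ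
    from        : (b : ℕ) → Graph.Vertex H b → ℕ
    to-vertex   : ∀ a → Graph.Vertex H (to a)
    to-from     : ∀ b vb → to (from b vb) ≡ b
    from-to     : ∀ a vb → from (to a) vb ≡ a
    to-adjacent : ∀ a c → Graph.adjacent H (to a) (to c) ≡ Graph.adjacent G a c

module _ (G H : Graph) (total : ∀ a → Graph.Vertex G a) where

  private
    Stage : Set
    Stage = Σ Pairs (IsPartialIso G H)

    next : ℕ → Stage → Stage
    next n (P , iso) = Enlargement.pairs r , Enlargement.isPartialIso r
      where r = round iso n

    stage : ℕ → Stage
    stage zero = [] , []-isPartialIso G H
    stage (suc n) = next n (stage n)

    pairs-at : ℕ → Pairs
    pairs-at n = proj₁ (stage n)

    covers-at : ∀ n → (Graph.Vertex G n → ∃ λ b → (n , b) ∈ pairs-at (suc n))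
                    × (Graph.Vertex H n → ∃ λ a → (a , n) ∈ pairs-at (suc n))
    covers-at n = Enlargement.covers (round (proj₂ (stage n)) n)

    stage-⊆ : ∀ k m → pairs-at m ⊆ pairs-at (k + m)
    stage-⊆ zero m = λ p∈ → p∈
    stage-⊆ (suc k) m = Enlargement.⊇old (round (proj₂ (stage (k + m))) (k + m)) ∘ stage-⊆ k m

    module Union m n {p q} (p∈ : p ∈ pairs-at m) (q∈ : q ∈ pairs-at n) where
      open IsPartialIso (proj₂ (stage (n + m))) public
      p∈∪ : p ∈ pairs-at (n + m)
      p∈∪ = stage-⊆ n m p∈
      q∈∪ : q ∈ pairs-at (n + m)
      q∈∪ = subst (λ k → q ∈ pairs-at k) (+-comm m n) (stage-⊆ m n q∈)

    to : ℕ → ℕ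
    to a = proj₁ (proj₁ (covers-at a) (total a))

    to-∈ : ∀ a → (a , to a) ∈ pairs-at (suc a)
    to-∈ a = proj₂ (proj₁ (covers-at a) (total a))

    from : (b : ℕ) → Graph.Vertex H b → ℕ
    from b vb = proj₁ (proj₂ (covers-at b) vb)

    from-∈ : ∀ b vb → (from b vb , b) ∈ pairs-at (suc b)
    from-∈ b vb = proj₂ (proj₂ (covers-at b) vb)

  back-and-forth : Isomorphism G H
  back-and-forth = record
    { to = to
    ; from = from
    ; to-vertex = λ a → IsPartialIso.cod (proj₂ (stage (suc a))) (to-∈ a)
    ; to-from = λ b vb →
        let open Union (suc (from b vb)) (suc b) (to-∈ (from b vb)) (from-∈ b vb) in functional p∈∪ q∈∪ refl
    ; from-to = λ a vb →
        let open Union (suc (to a)) (suc a) (from-∈ (to a) vb) (to-∈ a) in injective p∈∪ q∈∪ refl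
    ; to-adjacent = λ a c →
        let open Union (suc a) (suc c) (to-∈ a) (to-∈ c) in sym (preserves p∈∪ q∈∪)
    }

Finite-⋃ : ∀ {R : ℕ → ℕ → Set} (xs : List ℕ) → All (λ x → Finite (R x)) xs →
  Finite (λ w → ∃ λ x → x ∈ xs × R x w)
Finite-⋃ [] [] = [] , λ { _ (_ , () , _) }
Finite-⋃ (x ∷ xs) ((L , L-covers) ∷ finite) =
  L ++ proj₁ rest ,
  λ { w (_ , here refl , r) → ∈-++⁺ˡ (L-covers w r)
    ; w (y , there y∈xs , r) → ∈-++⁺ʳ L (proj₂ rest w (y , y∈xs , r)) }
  where rest = Finite-⋃ xs finite

avoid-image : ∀ {P : ℕ → Set} (f : ℕ → ℕ) → Injective _≡_ _≡_ f →
  (∀ X → ∃ λ z → z ∉ X × P z) → ∀ L X → ∃ λ z → z ∉ X × f z ∉ L × P z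
avoid-image f f-inj avoid [] X = let (z , z∉X , pz) = avoid X in z , z∉X , (λ ()) , pz
avoid-image f f-inj avoid (l ∷ L) X with avoid-image f f-inj avoid L X
... | z , z∉X , fz∉L , pz with f z ≟ l
...   | no fz≢l = z , z∉X , (λ { (here fz≡l) → fz≢l fz≡l ; (there fz∈L) → fz∉L fz∈L }) , pz
-- Search again avoiding z as well: by injectivity the new witness misses l.
...   | yes fz≡l with avoid-image f f-inj avoid L (z ∷ X)
...     | z′ , z′∉z∷X , fz′∉L , pz′ =
  z′ , z′∉z∷X ∘ there ,
  (λ { (here fz′≡l) → z′∉z∷X (here (f-inj (trans fz′≡l (sym fz≡l)))) ; (there fz′∈L) → fz′∉L fz′∈L }) ,
  pz′

_⁻¹ : Perm → Perm
g ⁻¹ = record { fun = inv g ; inv = fun g ; inv-fun = fun-inv g ; fun-inv = inv-fun g }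

module Rado {adj : Adj} (rado : IsRado adj) where

  private
    adj-sym : Symmetric adj
    adj-sym = proj₁ rado
    adj-irrefl : Irreflexive adj
    adj-irrefl = proj₁ (proj₂ rado)

  rado-graph : Graph
  rado-graph = record
    { Vertex = λ _ → ⊤
    ; vertex? = λ _ → yes tt
    ; adjacent = adj
    ; adjacent-sym = adj-sym
    ; adjacent-irrefl = adj-irrefl
    ; extension = λ A B _ _ A#B → let (z , z~A , z≁B) = proj₂ (proj₂ rado) A B A#B in z , tt , z~A , z≁B
    }

  rado-avoiding : ∀ A B X → Disjoint A B →
    ∃ λ z → z ∉ X × (∀ a → a ∈ A → adj z a ≡ true) × (∀ b → b ∈ B → adj z b ≡ false)
  rado-avoiding A B X A#B =
    let (z , _ , spec) = Graph.extension-avoiding rado-graph A B X (All.tabulate _) (All.tabulate _) A#B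
    in z , spec

  edge-embedding-injective : ∀ {E} (e : Edge adj E) → Injective _≡_ _≡_ (proj₁ e)
  edge-embedding-injective (f , _ , _ , _ , _ , f-adj) {i} {j} fi≡fj =
    Graph.neighbourhood-injective rado-graph tt tt λ z _ → begin
      adj z i          ≡⟨ sym (f-adj z i) ⟩
      adj (f z) (f i)  ≡⟨ cong (adj (f z)) fi≡fj ⟩
      adj (f z) (f j)  ≡⟨ f-adj z j ⟩
      adj z j          ∎
    where open ≡-Reasoning

  Edge-resp : ∀ {P Q : Subset} → (∀ x → P x → Q x) → (∀ x → Q x → P x) → Edge adj P → Edge adj Q
  Edge-resp P⇒Q Q⇒P e@(f , mem , h , f-h , _ , f-adj) =
    f , (λ i → P⇒Q (f i) (mem i)) , (λ x q → h x (Q⇒P x q)) , (λ x q → f-h x (Q⇒P x q)) ,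
    (λ i → edge-embedding-injective e (f-h (f i) _)) , f-adj

  -- Q need not be decidable, so it is enumerated by u from a decidable index set D.
  edge-from-extension : ∀ {Q : Subset} (D : ℕ → Set) → Decidable D → (u : ℕ → ℕ) →
    HasExtension D (λ i j → adj (u i) (u j)) →
    (∀ i → D i → Q (u i)) → (∀ y → Q y → ∃ λ i → D i × u i ≡ y) → Edge adj Q
  edge-from-extension {Q} D D? u extension into onto =
    u ∘ to , (λ k → into (to k) (to-vertex k)) , (λ y q → from (index y q) (index-∈D y q)) ,
    (λ y q → trans (cong u (to-from (index y q) (index-∈D y q))) (proj₂ (proj₂ (onto y q)))) ,
    (λ k → from-index (proj₂ (proj₂ (onto (u (to k)) _)))) ,
    to-adjacent
    where
    pulled-back : Graph
    pulled-back = record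
      { Vertex = D ; vertex? = D? ; adjacent = λ i j → adj (u i) (u j)
      ; adjacent-sym = λ i j → adj-sym (u i) (u j) ; adjacent-irrefl = λ i → adj-irrefl (u i)
      ; extension = extension }
    open Isomorphism (back-and-forth rado-graph pulled-back (λ _ → tt))
    index : ∀ y → Q y → ℕ
    index y q = proj₁ (onto y q)
    index-∈D : ∀ y q → D (index y q)
    index-∈D y q = proj₁ (proj₂ (onto y q))
    from-index : ∀ {k i} {vi : D i} → u i ≡ u (to k) → from i vi ≡ k
    from-index {k} {i} {vi} ui≡utk with Graph.neighbourhood-injective pulled-back vi (to-vertex k)
                                         (λ z _ → cong (adj (u z)) ui≡utk)
    ... | refl = from-to k vi

  not-changed : ∀ {g v w} → ¬ Changes adj g v w → adj v w ≡ adj (fun g v) (fun g w)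
  not-changed {g} {v} {w} = decidable-stable (adj v w ≟ᵇ adj (fun g v) (fun g w))

  Finite-changes-⁻¹ : ∀ g v → Finite (Changes adj g (inv g v)) → Finite (Changes adj (g ⁻¹) v)
  Finite-changes-⁻¹ g v (L , L-covers) =
    map (fun g) L ,
    λ w changed → subst (_∈ map (fun g) L) (fun-inv g w) (∈-map⁺ (fun g) (L-covers (inv g w) λ same →
      changed (trans (sym (cong₂ adj (fun-inv g v) (fun-inv g w))) (sym same))))

  edge-image : ∀ {E} (g : Perm) (S : List ℕ) → (∀ v → v ∉ S → Finite (Changes adj g v)) →
    Edge adj E → Edge adj ((E ∖ S) · g)
  edge-image {E} g S finite e@(f , mem , h , f-h , _ , f-adj) =
    edge-from-extension (λ i → f i ∉ S) (λ i → ¬? (f i ∈? S)) (fun g ∘ f) extension into onto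
    where
    into : ∀ i → f i ∉ S → ((E ∖ S) · g) (fun g (f i))
    into i fi∉S = subst (λ x → E x × x ∉ S) (sym (inv-fun g (f i))) (mem i , fi∉S)
    onto : ∀ y → ((E ∖ S) · g) y → ∃ λ i → f i ∉ S × fun g (f i) ≡ y
    onto y (x∈E , x∉S) =
      h (inv g y) x∈E , subst (_∉ S) (sym (f-h _ x∈E)) x∉S , trans (cong (fun g) (f-h _ x∈E)) (fun-inv g y)
    extension : HasExtension (λ i → f i ∉ S) (λ i j → adj (fun g (f i)) (fun g (f j)))
    extension A B A∉S B∉S A#B = z , fz∉S , (λ a a∈A → trans (kept (∈-++⁺ˡ a∈A)) (z~A a a∈A)) ,
                                          (λ b b∈B → trans (kept (∈-++⁺ʳ A b∈B)) (z≁B b b∈B))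
      where
      changed : Finite (λ w → ∃ λ x → x ∈ map f (A ++ B) × Changes adj g x w)
      changed = Finite-⋃ (map f (A ++ B)) (map⁺ (All.map (finite _) (A∉S ++ᴬ B∉S)))
      z-spec = avoid-image f (edge-embedding-injective e) (λ X → rado-avoiding A B X A#B)
                 (S ++ proj₁ changed) []
      z = proj₁ z-spec
      fz∉S∪changed = proj₁ (proj₂ (proj₂ z-spec))
      fz∉S : f z ∉ S
      fz∉S = fz∉S∪changed ∘ ∈-++⁺ˡ
      z~A = proj₁ (proj₂ (proj₂ (proj₂ z-spec)))
      z≁B = proj₂ (proj₂ (proj₂ (proj₂ z-spec)))
      kept : ∀ {a} → a ∈ A ++ B → adj (fun g (f z)) (fun g (f a)) ≡ adj z a
      kept {a} a∈ = begin
        adj (fun g (f z)) (fun g (f a))  ≡⟨ adj-sym _ _ ⟩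
        adj (fun g (f a)) (fun g (f z))  ≡⟨ sym (not-changed {g} λ ch →
                                              fz∉S∪changed (∈-++⁺ʳ S (proj₂ changed (f z) (f a , ∈-map⁺ f a∈ , ch)))) ⟩
        adj (f a) (f z)                  ≡⟨ f-adj a z ⟩
        adj a z                          ≡⟨ adj-sym a z ⟩
        adj z a                          ∎
        where open ≡-Reasoning

  no-dominating-vertex : ∀ {E x} → Edge adj E → E x → ¬ (∀ y → E y → y ≢ x → adj x y ≡ true)
  no-dominating-vertex {E} {x} e@(f , mem , h , f-h , _ , f-adj) x∈E dominated = true≢false (begin
    true             ≡⟨ sym (dominated (f z) (mem z) fz≢x) ⟩
    adj x (f z)      ≡⟨ cong (λ t → adj t (f z)) (sym (f-h x x∈E)) ⟩
    adj (f i) (f z)  ≡⟨ f-adj i z ⟩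
    adj i z          ≡⟨ adj-sym i z ⟩
    adj z i          ≡⟨ proj₂ (proj₂ (proj₂ z-spec)) i (here refl) ⟩
    false            ∎)
    where
    open ≡-Reasoning
    i = h x x∈E
    z-spec = rado-avoiding [] (i ∷ []) (i ∷ []) (λ _ ())
    z = proj₁ z-spec
    fz≢x : f z ≢ x
    fz≢x fz≡x = proj₁ (proj₂ z-spec) (here (edge-embedding-injective e (trans fz≡x (sym (f-h x x∈E)))))

  AutH⊆FAutH : ∀ g → InAutH adj g → InFAutH adj g
  AutH⊆FAutH g aut = [] , λ E e →
    Edge-resp (λ _ x → x , λ ()) (λ _ → proj₁) (proj₁ (aut E) e) ,
    Edge-resp (λ _ x → x , λ ()) (λ _ → proj₁)
      (proj₂ (aut (E ·⁻¹ g)) (Edge-resp (λ y → subst E (sym (fun-inv g y))) (λ y → subst E (fun-inv g y)) e))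

  Aut₂⊆AutH : ∀ g → InAut₂ adj g → InAutH adj g
  Aut₂⊆AutH g aut₂ E = image , preimage
    where
    image : Edge adj E → Edge adj (E · g)
    image e = Edge-resp (λ _ → proj₁) (λ _ x → x , λ ()) (edge-image g [] (λ v _ → aut₂ v) e)
    preimage : Edge adj (E · g) → Edge adj E
    preimage e =
      Edge-resp (λ y → subst E (inv-fun g y) ∘ proj₁) (λ y x → subst E (sym (inv-fun g y)) x , λ ())
        (edge-image (g ⁻¹) [] (λ v _ → Finite-changes-⁻¹ g v (aut₂ (inv g v))) e)

  -- The set S ∪ gS makes both g and g⁻¹ change finitely many adjacencies at every remaining vertex.
  Aut₃⊆FAutH : ∀ g → InAut₃ adj g → InFAutH adj g
  Aut₃⊆FAutH g (S , aut₃) = S ++ map (fun g) S , λ E e →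
    edge-image g _ (λ v v∉ → aut₃ v (v∉ ∘ ∈-++⁺ˡ)) e ,
    edge-image (g ⁻¹) _ (λ v v∉ → Finite-changes-⁻¹ g v (aut₃ (inv g v) λ g⁻¹v∈S →
      v∉ (∈-++⁺ʳ S (subst (_∈ map (fun g) S) (fun-inv g v) (∈-map⁺ (fun g) g⁻¹v∈S))))) e

  FSym⊆Aut₃ : ∀ g → InFSym g → InAut₃ adj g
  FSym⊆Aut₃ g (S , fixed) = S , λ v v∉S → S , λ w changed → changed-in-S v w v∉S changed
    where
    changed-in-S : ∀ v w → v ∉ S → Changes adj g v w → w ∈ S
    changed-in-S v w v∉S changed with w ∈? S
    ... | yes w∈S = w∈S
    ... | no w∉S = ⊥-elim (changed (sym (cong₂ adj (fixed v v∉S) (fixed w w∉S))))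

  FSym⊆FAutH : ∀ g → InFSym g → InFAutH adj g
  FSym⊆FAutH g = Aut₃⊆FAutH g ∘ FSym⊆Aut₃ g

  FSym∩AutH-trivial : ∀ g → InFSym g → InAutH adj g → IsIdentity g
  FSym∩AutH-trivial g (S , fixed) aut x with fun g x ≟ x
  ... | yes gx≡x = gx≡x
  ... | no gx≢x = ⊥-elim (no-dominating-vertex (proj₂ (aut C) Cg-edge) (inj₁ refl) x-dominates)
    where
    C : Subset
    C z = z ≡ x ⊎ (adj x z ≡ true × z ∉ S)
    x-dominates : ∀ y → C y → y ≢ x → adj x y ≡ true
    x-dominates y (inj₁ y≡x) y≢x = ⊥-elim (y≢x y≡x)
    x-dominates y (inj₂ (x~y , _)) _ = x~y
    Cg? : Decidable (C · g)
    Cg? y = (inv g y ≟ x) ⊎-dec ((adj x (inv g y) ≟ᵇ true) ×-dec ¬? (inv g y ∈? S))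
    inv-fixed : ∀ z → z ∉ S → inv g z ≡ z
    inv-fixed z z∉S = trans (cong (inv g) (sym (fixed z z∉S))) (inv-fun g z)
    x∉Cg : ¬ (C · g) x
    x∉Cg (inj₁ g⁻¹x≡x) = gx≢x (trans (cong (fun g) (sym g⁻¹x≡x)) (fun-inv g x))
    x∉Cg (inj₂ (x~g⁻¹x , g⁻¹x∉S)) =
      true≢false (trans (sym x~g⁻¹x) (trans (cong (adj x) (sym x≡g⁻¹x)) (adj-irrefl x)))
      where
      x≡g⁻¹x : x ≡ inv g x
      x≡g⁻¹x = trans (sym (fun-inv g x)) (fixed (inv g x) g⁻¹x∉S)
    -- Since x ∉ Cg, a witness may also be required adjacent to x and outside S, which puts it in Cg.
    extension : HasExtension (C · g) adj
    extension A B _ B⊆Cg A#B = z , z∈Cg , (λ a a∈A → z~x∷A a (there a∈A)) , z≁B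
      where
      x∷A#B : Disjoint (x ∷ A) B
      x∷A#B _ (here refl) x∈B = x∉Cg (All.lookup B⊆Cg x∈B)
      x∷A#B y (there y∈A) y∈B = A#B y y∈A y∈B
      z-spec = rado-avoiding (x ∷ A) B S x∷A#B
      z = proj₁ z-spec
      z∉S = proj₁ (proj₂ z-spec)
      z~x∷A = proj₁ (proj₂ (proj₂ z-spec))
      z≁B = proj₂ (proj₂ (proj₂ z-spec))
      z∈Cg : (C · g) z
      z∈Cg = subst C (sym (inv-fixed z z∉S)) (inj₂ (trans (adj-sym x z) (z~x∷A x (here refl)) , z∉S))
    Cg-edge : Edge adj (C · g)
    Cg-edge = edge-from-extension {Q = C · g} (C · g) Cg? (λ y → y) extension
                (λ _ y∈ → y∈) (λ y y∈ → y , y∈ , refl)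

swap01 : ℕ → ℕ
swap01 0 = 1
swap01 1 = 0
swap01 (suc (suc n)) = suc (suc n)

swap01-involutive : ∀ n → swap01 (swap01 n) ≡ n
swap01-involutive 0 = refl
swap01-involutive 1 = refl
swap01-involutive (suc (suc n)) = refl

transposition01 : Perm
transposition01 = record
  { fun = swap01 ; inv = swap01 ; inv-fun = swap01-involutive ; fun-inv = swap01-involutive }

transposition01-finitary : InFSym transposition01
transposition01-finitary = 0 ∷ 1 ∷ [] , fixed
  where
  fixed : ∀ x → x ∉ 0 ∷ 1 ∷ [] → swap01 x ≡ x
  fixed 0 x∉ = ⊥-elim (x∉ (here refl))
  fixed 1 x∉ = ⊥-elim (x∉ (there (here refl)))
  fixed (suc (suc n)) _ = refl

proposition2p2 : (adj : Adj) → IsRado adj →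
    ((∀ g → InAutH adj g → InFAutH adj g) × Σ Perm (λ g → InFAutH adj g × ¬ InAutH adj g)) ×
    ((∀ g → InAut₂ adj g → InAutH adj g) × (∀ g → InAut₃ adj g → InFAutH adj g)) ×
    ((∀ g → InFSym g → InFAutH adj g) × (∀ g → InFSym g → InAutH adj g → IsIdentity g))
proposition2p2 adj rado =
  (AutH⊆FAutH , transposition01 , FSym⊆FAutH transposition01 transposition01-finitary , transposition01∉AutH) ,
  (Aut₂⊆AutH , Aut₃⊆FAutH) ,
  (FSym⊆FAutH , FSym∩AutH-trivial)
  where
  open Rado rado
  transposition01∉AutH : ¬ InAutH adj transposition01
  transposition01∉AutH aut = 1+n≢0 (FSym∩AutH-trivial transposition01 transposition01-finitary aut 0)
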